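{- Let $k \ge 4$, let $G$ be an $SQSR(n, k, 0; k-1, k-2, k-3)$ graph, and let $u \in V(G)$. Then the number of edges of $G$ with one endpoint in $N(u)$ and the other in $V(G) \setminus N[u]$ equals $k(k-1)$.
   Context: All graphs are finite and simple. $N(v)$ is the set of neighbours of $v$ and $N[v] = N(v)\cup\{v\}$. A $QSR(n,k,a;c_1,\ldots,c_p)$ graph is a $k$-regular graph on $n$ vertices such that any two adjacent vertices have exactly $a$ common neighbours and any two distinct non-adjacent vertices have exactly $c_i$ common neighbours for some $1 \le i \le p$. Its grade is the number of indices $i$ for which there actually exist two non-adjacent vertices with exactly $c_i$ common neighbours; it is proper if its grade is $p$. An $SQSR(n,k,a;c_1,\ldots,c_p)$ graph is a proper $QSR(n,k,a;c_1,\ldots,c_p)$ graph in which $a, c_1, \ldots, c_p$ are pairwise distinct. -}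

module Defs where

open import Data.Nat using (ℕ; _+_; _*_; _∸_; _≤_)
open import Data.Bool using (Bool; true; false; _∧_; not; if_then_else_)
open import Data.Fin using (Fin; _≟_)
open import Data.List using (List; []; _∷_; map; allFin)
open import Data.Nat.ListAction using (sum)
open import Data.List.Membership.Propositional using (_∈_)
open import Data.List.Relation.Unary.Unique.Propositional using (Unique)
open import Data.Product using (Σ; _×_; ∃-syntax)
open import Relation.Nullary using (¬_)
open import Relation.Nullary.Decidable using (isYes)
open import Relation.Binary.PropositionalEquality using (_≡_)

record SimpleGraph (n : ℕ) : Set where
  field
    adj     : Fin n → Fin n → Bool
    adjSym  : ∀ i j → adj i j ≡ adj j i
    adjIrr  : ∀ i → adj i i ≡ false
open SimpleGraph public

count : {n : ℕ} → (Fin n → Bool) → ℕ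
count {n} p = sum (map (λ i → if p i then 1 else 0) (allFin n))

module _ {n : ℕ} (G : SimpleGraph n) where


  degree : Fin n → ℕ
  degree v = count (adj G v)

  commonNbrs : Fin n → Fin n → ℕ
  commonNbrs u v = count (λ w → adj G u w ∧ adj G v w)

  IsRegular : ℕ → Set
  IsRegular k = ∀ v → degree v ≡ k

  -- QSR(n,k,a;c₁,…,c_p), with the c's given as the list cs
  IsQSR : ℕ → ℕ → List ℕ → Set
  IsQSR k a cs =
      IsRegular k
    × (∀ u v → adj G u v ≡ true → commonNbrs u v ≡ a)
    × (∀ u v → ¬ (u ≡ v) → adj G u v ≡ false → commonNbrs u v ∈ cs)

  IsProper : List ℕ → Set
  IsProper cs = ∀ c → c ∈ cs →
    ∃[ u ] ∃[ v ] (¬ (u ≡ v) × adj G u v ≡ false × commonNbrs u v ≡ c)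

  IsSQSR : ℕ → ℕ → List ℕ → Set
  IsSQSR k a cs = IsQSR k a cs × IsProper cs × Unique (a ∷ cs)

  inN : Fin n → Fin n → Bool
  inN u x = adj G u x

  outsideN[] : Fin n → Fin n → Bool
  outsideN[] u y = not (isYes (y ≟ u)) ∧ not (adj G u y)

  -- Since these two sets are disjoint, each such edge is counted exactly once
  -- as an ordered pair (x , y) with x ∈ N(u), y ∉ N[u], x ~ y.
  edgesOut : Fin n → ℕ
  edgesOut u =
    sum (map (λ x → if inN u x
                      then count (λ y → outsideN[] u y ∧ adj G x y)
                      else 0) (allFin n))

{-# OPTIONS --safe #-}
-- Only k-regularity and a = 0 matter: in a triangle-free graph a neighbour x of u has no
-- neighbour in N(u), so its k neighbours are u and k - 1 vertices outside N[u]. Summing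
-- over the k neighbours of u gives k(k - 1).
module Submission where

open import Defs
open import Data.Bool using (Bool; true; false; _∧_; not; if_then_else_)
open import Data.Fin using (Fin; _≟_)
open import Data.List using (List; []; _∷_; map; allFin)
open import Data.List.Membership.Propositional using (_∈_)
open import Data.List.Membership.Propositional.Properties using (∈-allFin)
open import Data.List.Properties using (map-cong)
open import Data.List.Relation.Unary.All as All using (All; []; _∷_)
open import Data.List.Relation.Unary.Any using (here; there)
open import Data.List.Relation.Unary.AllPairs using ([]; _∷_)
open import Data.List.Relation.Unary.Unique.Propositional using (Unique)
open import Data.List.Relation.Unary.Unique.Propositional.Properties using (allFin⁺)
open import Data.Nat using (ℕ; _≤_; _+_; _*_; _∸_)
open import Data.Nat.ListAction using (sum)
open import Data.Nat.Properties using (+-identityʳ; *-distribʳ-+; m+n∸m≡n; +-commutativeSemigroup)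
open import Algebra.Properties.CommutativeSemigroup +-commutativeSemigroup using (interchange)
open import Data.Product using (_,_)
open import Data.Empty using (⊥-elim)
open import Relation.Nullary using (¬_; yes; no)
open import Relation.Nullary.Decidable using (isYes)
open import Relation.Binary.PropositionalEquality using (_≡_; refl; sym; trans; cong; cong₂; module ≡-Reasoning)

ind : Bool → ℕ
ind b = if b then 1 else 0

module _ {A : Set} where

  sum-map-+ : (f g : A → ℕ) (xs : List A) →
    sum (map (λ x → f x + g x) xs) ≡ sum (map f xs) + sum (map g xs)
  sum-map-+ f g [] = refl
  sum-map-+ f g (x ∷ xs) = begin
    f x + g x + sum (map (λ x → f x + g x) xs)     ≡⟨ cong (f x + g x +_) (sum-map-+ f g xs) ⟩
    f x + g x + (sum (map f xs) + sum (map g xs))  ≡⟨ interchange (f x) (g x) _ _ ⟩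
    f x + sum (map f xs) + (g x + sum (map g xs))  ∎
    where open ≡-Reasoning

  sum-map-*ʳ : (f : A → ℕ) (c : ℕ) (xs : List A) →
    sum (map (λ x → f x * c) xs) ≡ sum (map f xs) * c
  sum-map-*ʳ f c [] = refl
  sum-map-*ʳ f c (x ∷ xs) =
    trans (cong (f x * c +_) (sum-map-*ʳ f c xs)) (sym (*-distribʳ-+ c (f x) _))

  sum-map-cong : {f g : A → ℕ} → (∀ x → f x ≡ g x) → (xs : List A) →
    sum (map f xs) ≡ sum (map g xs)
  sum-map-cong f≗g xs = cong sum (map-cong f≗g xs)

  sum-map-≡0 : {f : A → ℕ} {xs : List A} → All (λ x → f x ≡ 0) xs → sum (map f xs) ≡ 0
  sum-map-≡0 [] = refl
  sum-map-≡0 (fx≡0 ∷ fxs≡0) = cong₂ _+_ fx≡0 (sum-map-≡0 fxs≡0)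

module _ {n : ℕ} where

  ind-≟-≡0 : {u y : Fin n} → ¬ y ≡ u → ind (isYes (y ≟ u)) ≡ 0
  ind-≟-≡0 {u} {y} y≢u with y ≟ u
  ... | yes y≡u = ⊥-elim (y≢u y≡u)
  ... | no _    = refl

  sum-ind-≟-unique : {u : Fin n} {xs : List (Fin n)} → Unique xs → u ∈ xs →
    sum (map (λ y → ind (isYes (y ≟ u))) xs) ≡ 1
  sum-ind-≟-unique {u} (u≢xs ∷ _) (here refl) with u ≟ u
  ... | yes _  = cong (1 +_) (sum-map-≡0 (All.map (λ u≢y → ind-≟-≡0 (λ y≡u → u≢y (sym y≡u))) u≢xs))
  ... | no u≢u = ⊥-elim (u≢u refl)
  sum-ind-≟-unique {u} {x ∷ _} (x≢xs ∷ xs!) (there u∈xs) =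
    cong₂ _+_ (ind-≟-≡0 x≢u) (sum-ind-≟-unique xs! u∈xs)
    where x≢u : ¬ x ≡ u
          x≢u refl = All.lookup x≢xs u∈xs refl

  count-≟ : (u : Fin n) → count (λ y → isYes (y ≟ u)) ≡ 1
  count-≟ u = sum-ind-≟-unique (allFin⁺ n) (∈-allFin u)

  count-split₃ : {p q r s : Fin n → Bool} → (∀ y → ind (p y) ≡ ind (q y) + ind (r y) + ind (s y)) →
    count p ≡ count q + count r + count s
  count-split₃ {p} {q} {r} {s} split = begin
    count p                                                     ≡⟨ sum-map-cong split (allFin n) ⟩
    sum (map (λ y → ind (q y) + ind (r y) + ind (s y)) (allFin n)) ≡⟨ sum-map-+ (λ y → ind (q y) + ind (r y)) (λ y → ind (s y)) (allFin n) ⟩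
    sum (map (λ y → ind (q y) + ind (r y)) (allFin n)) + count s ≡⟨ cong (_+ count s) (sum-map-+ (λ y → ind (q y)) (λ y → ind (r y)) (allFin n)) ⟩
    count q + count r + count s                                 ∎
    where open ≡-Reasoning

module _ {n : ℕ} (G : SimpleGraph n) where

  IsTriangleFree : Set
  IsTriangleFree = ∀ u v → adj G u v ≡ true → commonNbrs G u v ≡ 0

  nbrsOutsideN[] : Fin n → Fin n → ℕ
  nbrsOutsideN[] u x = count (λ y → outsideN[] G u y ∧ adj G x y)

  edgesOut-≡-degree-* : {c : ℕ} (u : Fin n) →
    (∀ x → adj G u x ≡ true → nbrsOutsideN[] u x ≡ c) → edgesOut G u ≡ degree G u * c
  edgesOut-≡-degree-* {c} u nbrsOutside≡c =
    trans (sum-map-cong term≡ (allFin n)) (sum-map-*ʳ (λ x → ind (adj G u x)) c (allFin n))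
    where
    term≡ : ∀ x → (if adj G u x then nbrsOutsideN[] u x else 0) ≡ ind (adj G u x) * c
    term≡ x with adj G u x in ux
    ... | true  = trans (nbrsOutside≡c x ux) (sym (+-identityʳ c))
    ... | false = refl

  degree-nbr-split : (u x : Fin n) → adj G u x ≡ true →
    degree G x ≡ 1 + commonNbrs G u x + nbrsOutsideN[] u x
  degree-nbr-split u x ux =
    trans (count-split₃ split) (cong (λ m → m + commonNbrs G u x + nbrsOutsideN[] u x) (count-≟ u))
    where
    ind-∧-not-split : ∀ a b → ind b ≡ 0 + ind (a ∧ b) + ind (not a ∧ b)
    ind-∧-not-split true  b = sym (+-identityʳ (ind b))
    ind-∧-not-split false b = refl

    split : ∀ y → ind (adj G x y) ≡
      ind (isYes (y ≟ u)) + ind (adj G u y ∧ adj G x y) + ind (outsideN[] G u y ∧ adj G x y)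
    split y with y ≟ u
    ... | yes refl rewrite adjIrr G u | adjSym G x u | ux = refl
    ... | no _     = ind-∧-not-split (adj G u y) (adj G x y)

  nbrsOutsideN[]-triangleFree : {k : ℕ} → IsRegular G k → IsTriangleFree →
    (u x : Fin n) → adj G u x ≡ true → nbrsOutsideN[] u x ≡ k ∸ 1
  nbrsOutsideN[]-triangleFree {k} regular triangleFree u x ux = begin
    nbrsOutsideN[] u x                            ≡⟨ m+n∸m≡n 1 (nbrsOutsideN[] u x) ⟨
    1 + nbrsOutsideN[] u x ∸ 1                    ≡⟨ cong (λ c → 1 + c + nbrsOutsideN[] u x ∸ 1) (triangleFree u x ux) ⟨
    1 + commonNbrs G u x + nbrsOutsideN[] u x ∸ 1 ≡⟨ cong (_∸ 1) (degree-nbr-split u x ux) ⟨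
    degree G x ∸ 1                                ≡⟨ cong (_∸ 1) (regular x) ⟩
    k ∸ 1                                         ∎
    where open ≡-Reasoning

  edgesOut-triangleFree : {k : ℕ} → IsRegular G k → IsTriangleFree →
    (u : Fin n) → edgesOut G u ≡ k * (k ∸ 1)
  edgesOut-triangleFree {k} regular triangleFree u =
    trans (edgesOut-≡-degree-* u (nbrsOutsideN[]-triangleFree regular triangleFree u))
          (cong (_* (k ∸ 1)) (regular u))

mainTheorem9 : (n k : ℕ) → 4 ≤ k → (G : SimpleGraph n) →
    IsSQSR G k 0 (k ∸ 1 ∷ k ∸ 2 ∷ k ∸ 3 ∷ []) →
    (u : Fin n) → edgesOut G u ≡ k * (k ∸ 1)
mainTheorem9 n k _ G ((regular , triangleFree , _) , _) = edgesOut-triangleFree G regular triangleFree
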